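{- Let $\Omega$ and $A$ be sets, $T\colon\mathbf{Sets}\to\mathbf{Sets}$ a functor and $t\colon T(\Omega)\to\Omega$ a map. Then the set $\Omega^{A^*}$ carries a corecursive algebra for the functor $X\mapsto\Omega\times T(X)^A$ such that, for every coalgebra $\langle o,f\rangle\colon X\to\Omega\times T(X)^A$, the unique coalgebra-to-algebra morphism $\mathsf{log}\colon X\to\Omega^{A^*}$ satisfies $\mathsf{log}(x)(\varepsilon)=o(x)$ and $\mathsf{log}(x)(aw)=t\big(T(\mathrm{ev}_w\circ\mathsf{log})(f(x)(a))\big)$ for all $x\in X$, $a\in A$, $w\in A^*$.
   Context: $A^*$ is the set of finite words over $A$, $\varepsilon$ the empty word, and $\mathrm{ev}_w\colon\Omega^{A^*}\to\Omega$ is evaluation at $w$. For an endofunctor $K$, an algebra $\ell\colon K(\Theta)\to\Theta$ is corecursive if for every coalgebra $c\colon X\to K(X)$ there is a unique map $g\colon X\to\Theta$ (a coalgebra-to-algebra morphism) with $g=\ell\circ K(g)\circ c$. -}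

module Defs where

open import Data.List using (List; []; _∷_)
open import Data.Product using (Σ; _×_; _,_; proj₁; proj₂)
open import Function using (_∘_; id)
open import Relation.Binary.PropositionalEquality using (_≡_)

-- An endofunctor on Sets (Set₀), with the functor laws stated pointwise
-- (no function extensionality in Agda), plus congruence of fmap w.r.t.
-- pointwise equality of maps.
record Functor : Set₁ where
  field
    F        : Set → Set
    fmap     : {X Y : Set} → (X → Y) → F X → F Y
    fmap-cong : {X Y : Set} {f g : X → Y} → (∀ x → f x ≡ g x) → ∀ y → fmap f y ≡ fmap g y
    fmap-id  : {X : Set} → ∀ (y : F X) → fmap id y ≡ y
    fmap-∘   : {X Y Z : Set} {f : X → Y} {g : Y → Z} → ∀ y → fmap (g ∘ f) y ≡ fmap g (fmap f y)

Word : Set → Set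
Word A = List A

ev : {Ω A : Set} → Word A → (Word A → Ω) → Ω
ev w φ = φ w

_≈ᵂ_ : {Ω A : Set} → (Word A → Ω) → (Word A → Ω) → Set
φ ≈ᵂ ψ = ∀ w → φ w ≡ ψ w

IsCoalgAlgMorphism : (KF : Set → Set) (Kmap : {X Y : Set} → (X → Y) → KF X → KF Y)
  {Θ : Set} (_≈_ : Θ → Θ → Set) (ℓ : KF Θ → Θ)
  {X : Set} (c : X → KF X) (g : X → Θ) → Set
IsCoalgAlgMorphism KF Kmap _≈_ ℓ c g = ∀ x → g x ≈ ℓ (Kmap g (c x))

IsCorecursive : (KF : Set → Set) (Kmap : {X Y : Set} → (X → Y) → KF X → KF Y)
  {Θ : Set} (_≈_ : Θ → Θ → Set) (ℓ : KF Θ → Θ) → Set₁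
IsCorecursive KF Kmap _≈_ ℓ =
  ∀ {X : Set} (c : X → KF X) →
    Σ (X → _) λ g → IsCoalgAlgMorphism KF Kmap _≈_ ℓ c g ×
      (∀ g' → IsCoalgAlgMorphism KF Kmap _≈_ ℓ c g' → ∀ x → g' x ≈ g x)

KF : (Ω A : Set) (T : Functor) → Set → Set
KF Ω A T X = Ω × (A → Functor.F T X)

Kmap : (Ω A : Set) (T : Functor) → {X Y : Set} → (X → Y) → KF Ω A T X → KF Ω A T Y
Kmap Ω A T g (o , φ) = o , (λ a → Functor.fmap T g (φ a))

-- The algebra reads a word letter by letter: on ε it returns the output
-- component, and on a ∷ w it evaluates the a-successor family at w and
-- collapses the resulting T Ω with t. A coalgebra-to-algebra morphism into
-- it is therefore forced by recursion on the word, which gives both its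
-- existence and its uniqueness.
module Submission where

open import Defs
open import Data.List using ([]; _∷_)
open import Data.Product using (Σ; _×_; _,_; proj₁; proj₂)
open import Function using (_∘_)
open import Relation.Binary.PropositionalEquality using (_≡_; refl; sym; trans; cong; module ≡-Reasoning)

module WordAlgebra (Ω A : Set) (T : Functor) (t : Functor.F T Ω → Ω) where
  open Functor T

  K : Set → Set
  K = KF Ω A T

  IsMorphism : {X : Set} → (K (Word A → Ω) → Word A → Ω) → (X → K X) → (X → Word A → Ω) → Set
  IsMorphism ℓ c g = IsCoalgAlgMorphism K (Kmap Ω A T) _≈ᵂ_ ℓ c g

  wordAlgebra : K (Word A → Ω) → Word A → Ω
  wordAlgebra (o , φ) []      = o
  wordAlgebra (o , φ) (a ∷ w) = t (fmap (ev w) (φ a))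

  module _ {X : Set} (c : X → K X) where

    -- Word first, so that the recursive call under fmap is structural.
    unfoldAt : Word A → X → Ω
    unfoldAt []      x = proj₁ (c x)
    unfoldAt (a ∷ w) x = t (fmap (unfoldAt w) (proj₂ (c x) a))

    unfold : X → Word A → Ω
    unfold x w = unfoldAt w x

    unfold-isMorphism : IsMorphism wordAlgebra c unfold
    unfold-isMorphism x []      = refl
    unfold-isMorphism x (a ∷ w) = cong t (fmap-∘ (proj₂ (c x) a))

    morphism-unique : (g : X → Word A → Ω) → IsMorphism wordAlgebra c g →
                      ∀ x → g x ≈ᵂ unfold x
    morphism-unique g g-mor x []      = g-mor x []
    morphism-unique g g-mor x (a ∷ w) = begin
      g x (a ∷ w)                               ≡⟨ g-mor x (a ∷ w) ⟩
      t (fmap (ev w) (fmap g (proj₂ (c x) a)))  ≡⟨ cong t (sym (fmap-∘ (proj₂ (c x) a))) ⟩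
      t (fmap (ev w ∘ g) (proj₂ (c x) a))       ≡⟨ cong t (fmap-cong (λ y → morphism-unique g g-mor y w) (proj₂ (c x) a)) ⟩
      t (fmap (unfoldAt w) (proj₂ (c x) a))     ∎
      where open ≡-Reasoning

  wordAlgebra-isCorecursive : IsCorecursive K (Kmap Ω A T) _≈ᵂ_ wordAlgebra
  wordAlgebra-isCorecursive c = unfold c , unfold-isMorphism c , morphism-unique c

  morphism-cons : {X : Set} (o : X → Ω) (f : X → A → F X) (g : X → Word A → Ω) →
                  IsMorphism wordAlgebra (λ x → o x , f x) g →
                  ∀ x a w → g x (a ∷ w) ≡ t (fmap (ev w ∘ g) (f x a))
  morphism-cons o f g g-mor x a w = trans (g-mor x (a ∷ w)) (cong t (sym (fmap-∘ (f x a))))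

open WordAlgebra

proposition4p3 : (Ω A : Set) (T : Functor) (t : Functor.F T Ω → Ω) →
    Σ (KF Ω A T (Word A → Ω) → (Word A → Ω)) λ ℓ →
    IsCorecursive (KF Ω A T) (Kmap Ω A T) _≈ᵂ_ ℓ ×
    (∀ {X : Set} (o : X → Ω) (f : X → A → Functor.F T X) (lg : X → Word A → Ω) →
    IsCoalgAlgMorphism (KF Ω A T) (Kmap Ω A T) _≈ᵂ_ ℓ (λ x → o x , f x) lg →
    (∀ x → lg x [] ≡ o x) ×
    (∀ x a w → lg x (a ∷ w) ≡ t (Functor.fmap T (ev w ∘ lg) (f x a))))
proposition4p3 Ω A T t =
  wordAlgebra Ω A T t ,
  wordAlgebra-isCorecursive Ω A T t ,
  λ o f lg lg-mor → (λ x → lg-mor x []) , morphism-cons Ω A T t o f lg lg-mor
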